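{- Let $P$ be a Young composition tableau, and let $c\le d$ be positive integers. Form $d\to(c\to P)$, that is, first insert $c$ into $P$ and then insert $d$ into the result. The new cell created by the insertion of $d$ lies in a column strictly to the right of the new cell created by the insertion of $c$. Consequently, if a weakly increasing sequence $c_1\le c_2\le\cdots\le c_m$ is inserted into a Young composition tableau in this order, then the column indices of the successively created new cells are strictly increasing.
   Context: Compositions and diagrams use the French convention: the diagram of $\alpha=(\alpha_1,\dots,\alpha_\ell)$ has left-justified rows, row $j$ from the bottom having $\alpha_j$ cells, and cell $(i,j)$ is in column $i$ and row $j$. A Young composition tableau (YCT) of shape $\alpha$ is a filling $T$ of the diagram with positive integers such that: (1) rows weakly increase from left to right; (2) the leftmost column strictly increases from bottom to top; (3) for all $1\le j<k\le\ell$ and $1\le i<\max\{\alpha_j,\alpha_k\}$, if $T(i,k)\le T(i+1,j)$ then $T(i+1,k)<T(i+1,j)$, where cells outside the diagram count as $\infty$. The augmentation $\bar T$ is obtained by appending to each row one extra cell containing $\infty$. Young reading order lists the cells column by column from the rightmost column to the leftmost column, and within each column from top to bottom. Insertion $k\to T$ of a positive integer $k$: let $(c_1,d_1),(c_2,d_2),\dots$ be the cells of $\bar T$ not in the leftmost column, in Young reading order, and set $k_0:=k$. Let $i$ be the smallest index such that $\bar T(c_i-1,d_i)\le k_0<\bar T(c_i,d_i)$. - If $\bar T(c_i,d_i)=\infty$, place $k_0$ in cell $(c_i,d_i)$, which becomes the new cell, and stop. - Otherwise, place $k_0$ in $(c_i,d_i)$; the old entry is said to be bumped. Then repeat the procedure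 with the old entry as the new $k_0$, scanning only the cells $(c_{i+1},d_{i+1}),(c_{i+2},d_{i+2}),\dots$. - If no such index exists, create a new row containing only $k_0$ in the leftmost column, at the highest position such that all leftmost-column entries below it are smaller than $k_0$. Rows above this position are shifted up by one, and the cell containing $k_0$ is the new cell. The result $k\to T$ is again a Young composition tableau. -}

module Defs where

open import Data.Nat using (ℕ; zero; suc; _+_; _∸_; _≤_; _<_; _⊔_; _≤ᵇ_; _<ᵇ_)
open import Data.Bool using (Bool; true; false; if_then_else_; _∧_)
open import Data.List using (List; []; _∷_; [_]; length; map; concatMap; foldr; downFrom)
open import Data.List.Relation.Unary.All using (All)
open import Data.Product using (_×_; _,_; proj₁; proj₂)
open import Data.Unit using (⊤)
open import Data.Empty using (⊥)

-- Positive integers extended by ∞ (value of cells outside a diagram)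

data ℕ∞ : Set where
  fin : ℕ → ℕ∞
  ∞   : ℕ∞

_≤∞_ : ℕ∞ → ℕ∞ → Set
fin m ≤∞ fin n = m ≤ n
fin m ≤∞ ∞     = ⊤
∞     ≤∞ fin n = ⊥
∞     ≤∞ ∞     = ⊤

_<∞_ : ℕ∞ → ℕ∞ → Set
fin m <∞ fin n = m < n
fin m <∞ ∞     = ⊤
∞     <∞ _     = ⊥

_≤∞ᵇ_ : ℕ∞ → ℕ∞ → Bool
fin m ≤∞ᵇ fin n = m ≤ᵇ n
fin m ≤∞ᵇ ∞     = true
∞     ≤∞ᵇ fin n = false
∞     ≤∞ᵇ ∞     = true

_<∞ᵇ_ : ℕ∞ → ℕ∞ → Bool
fin m <∞ᵇ fin n = m <ᵇ n
fin m <∞ᵇ ∞     = true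
∞     <∞ᵇ _     = false

-- Tableaux (French convention): a list of rows, bottom row first;
-- each row is listed from left to right.

Row : Set
Row = List ℕ

Tableau : Set
Tableau = List Row

-- cells are (column , row), both 1-indexed
Cell : Set
Cell = ℕ × ℕ

rowAt : Tableau → ℕ → Row
rowAt []       _       = []
rowAt (r ∷ rs) zero    = r
rowAt (r ∷ rs) (suc j) = rowAt rs j

entryL : Row → ℕ → ℕ∞
entryL []       _       = ∞
entryL (x ∷ xs) zero    = fin x
entryL (x ∷ xs) (suc i) = entryL xs i

-- T(i,j): column i, row j (1-indexed); ∞ outside the diagram
entry : Tableau → ℕ → ℕ → ℕ∞
entry T zero    j       = ∞
entry T (suc i) zero    = ∞
entry T (suc i) (suc j) = entryL (rowAt T j) i

ℓ : Tableau → ℕ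
ℓ = length

α : Tableau → ℕ → ℕ
α T j = length (rowAt T (j ∸ 1))

record IsYCT (T : Tableau) : Set where
  field
    rowsNonempty : All (λ r → 1 ≤ length r) T
    positive     : All (All (1 ≤_)) T
    rowsWeak     : ∀ i j → 1 ≤ j → j ≤ ℓ T → 1 ≤ i → i < α T j →
                   entry T i j ≤∞ entry T (suc i) j
    colStrict    : ∀ j → 1 ≤ j → suc j ≤ ℓ T →
                   entry T 1 j <∞ entry T 1 (suc j)
    triple       : ∀ i j k → 1 ≤ j → j < k → k ≤ ℓ T →
                   1 ≤ i → i < α T j ⊔ α T k →
                   entry T i k ≤∞ entry T (suc i) j →
                   entry T (suc i) k <∞ entry T (suc i) j

-- set position i (0-indexed) of a row; i = length appends
setL : Row → ℕ → ℕ → Row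
setL []       _       k = [ k ]
setL (x ∷ xs) zero    k = k ∷ xs
setL (x ∷ xs) (suc i) k = x ∷ setL xs i k

setT : Tableau → ℕ → ℕ → ℕ → Tableau
setT []       _ _       _ = []
setT (r ∷ rs) i zero    k = setL r i k ∷ rs
setT (r ∷ rs) i (suc j) k = r ∷ setT rs i j k

place : Tableau → Cell → ℕ → Tableau
place T (c , d) k = setT T (c ∸ 1) (d ∸ 1) k

-- cells of the augmentation T̄ not in the leftmost column, in Young
-- reading order: columns from right (maxα+1) to left (2), each column
-- from top (row ℓ) to bottom (row 1)
maxα : Tableau → ℕ
maxα T = foldr _⊔_ 0 (map length T)

readingCells : Tableau → List Cell
readingCells T =
  concatMap (λ c → concatMap (λ d → if c ≤ᵇ α T d + 1 then [ (c , d) ] else [])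
                             (map suc (downFrom (ℓ T))))
            (map (2 +_) (downFrom (maxα T)))

newRow : ℕ → Tableau → Tableau × ℕ
newRow k []       = ([ k ] ∷ [] , 1)
newRow k (r ∷ rs) with entryL r 0 <∞ᵇ fin k
... | true  = (r ∷ proj₁ (newRow k rs) , suc (proj₂ (newRow k rs)))
... | false = ([ k ] ∷ r ∷ rs , 1)

scan : ℕ → List Cell → Tableau → Tableau × Cell
scan k [] T = (proj₁ (newRow k T) , (1 , proj₂ (newRow k T)))
scan k ((c , d) ∷ cs) T
  with (entry T (c ∸ 1) d ≤∞ᵇ fin k) ∧ (fin k <∞ᵇ entry T c d)
... | false = scan k cs T
... | true with entry T c d
...   | ∞     = (place T (c , d) k , (c , d))
...   | fin x = scan x cs (place T (c , d) k)

insertWithCell : ℕ → Tableau → Tableau × Cell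
insertWithCell k T = scan k (readingCells T) T

_⇒_ : ℕ → Tableau → Tableau
k ⇒ T = proj₁ (insertWithCell k T)

newCell : ℕ → Tableau → Cell
newCell k T = proj₂ (insertWithCell k T)

insertSeq : List ℕ → Tableau → Tableau × List Cell
insertSeq []       T = (T , [])
insertSeq (c ∷ cs) T =
  (proj₁ (insertSeq cs (c ⇒ T)) , newCell c T ∷ proj₂ (insertSeq cs (c ⇒ T)))

-- Inserting c into P leaves a bumping path in c → P: a sequence of cells p₀ ≺ p₁ ≺ … ≺ pₙ
-- in Young reading order such that p₀ holds at most c, each pᵢ₊₁ holds at most the entry
-- to the right of pᵢ, and pₙ is the new cell. Inserting d ≥ c then rescans the reading
-- cells; along the scan the value being carried always dominates some path cell p whose
-- right neighbour has not been scanned yet. When the scan reaches that neighbour the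
-- carried value either stops there (one column right of p), or moves on to the next path
-- cell, since the bumped entry dominates it. Hence d comes to rest strictly to the right
-- of the column of pₙ.
module Submission where

open import Defs
open import Data.Nat using (ℕ; zero; suc; _+_; _∸_; _>_; _≤_; _<_; _≤ᵇ_; z≤n; s≤s)
open import Data.Nat.Properties
open import Data.Bool using (true; false; _∧_; if_then_else_) renaming (T to True)
open import Data.List using (List; []; _∷_; [_]; length; map; concatMap; downFrom)
open import Data.List.Relation.Unary.All as All using (All; []; _∷_)
open import Data.List.Relation.Unary.AllPairs as AllPairs using (AllPairs; []; _∷_)
open import Data.List.Relation.Unary.Any using (here; there)
open import Data.List.Relation.Unary.Linked using (Linked; []; [-]; _∷_)
open import Data.List.Membership.Propositional using (_∈_; _∉_; lose)
import Data.List.Relation.Unary.All.Properties as Allₚ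
import Data.List.Relation.Unary.AllPairs.Properties as AllPairsₚ
import Data.List.Membership.Propositional.Properties as ∈ₚ
open import Data.Product using (_×_; _,_; proj₁; proj₂; Σ)
open import Data.Product.Properties using (≡-dec)
open import Data.Sum using (_⊎_; inj₁; inj₂)
open import Data.Unit using (tt)
open import Data.Empty using (⊥-elim)
open import Function using (id; _∘_)
open import Relation.Binary.Core using (_Preserves_⟶_)
open import Relation.Binary.Definitions using (DecidableEquality)
open import Relation.Binary.PropositionalEquality
  using (_≡_; _≢_; refl; sym; trans; cong; subst; subst₂)
open import Relation.Nullary using (¬_; yes; no)
open import Relation.Nullary.Reflects using (Reflects; ofʸ; ofⁿ; _×-reflects_)

≤∞-refl : ∀ a → a ≤∞ a
≤∞-refl (fin m) = ≤-refl
≤∞-refl ∞       = tt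

≤∞-reflexive : ∀ {a b} → a ≡ b → a ≤∞ b
≤∞-reflexive refl = ≤∞-refl _

≤∞-trans : ∀ {a b c} → a ≤∞ b → b ≤∞ c → a ≤∞ c
≤∞-trans {fin _} {fin _} {fin _} p q = ≤-trans p q
≤∞-trans {fin _} {fin _} {∞}     _ _ = tt
≤∞-trans {fin _} {∞}     {fin _} _ ()
≤∞-trans {fin _} {∞}     {∞}     _ _ = tt
≤∞-trans {∞}     {fin _}         () _
≤∞-trans {∞}     {∞}     {fin _} _ ()
≤∞-trans {∞}     {∞}     {∞}     _ _ = tt

≤∞-∞ : ∀ a → a ≤∞ ∞
≤∞-∞ (fin _) = tt
≤∞-∞ ∞       = tt

<∞⇒≤∞ : ∀ {a b} → a <∞ b → a ≤∞ b
<∞⇒≤∞ {fin _} {fin _} lt = <⇒≤ lt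
<∞⇒≤∞ {fin _} {∞}     _  = tt

≤fin⇒≢∞ : ∀ {a k} → a ≤∞ fin k → a ≢ ∞
≤fin⇒≢∞ {fin _} _ ()

∞≤⇒≡∞ : ∀ {a} → ∞ ≤∞ a → a ≡ ∞
∞≤⇒≡∞ {∞} _ = refl

≮∞⇒≥ : ∀ {k} b → ¬ (fin k <∞ b) → b ≤∞ fin k
≮∞⇒≥ (fin n) k≮n = ≮⇒≥ k≮n
≮∞⇒≥ ∞       k≮∞ = ⊥-elim (k≮∞ tt)

≤∞ᵇ-reflects : ∀ a b → Reflects (a ≤∞ b) (a ≤∞ᵇ b)
≤∞ᵇ-reflects (fin m) (fin n) = ≤ᵇ-reflects-≤ m n
≤∞ᵇ-reflects (fin _) ∞       = ofʸ tt
≤∞ᵇ-reflects ∞       (fin _) = ofⁿ id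
≤∞ᵇ-reflects ∞       ∞       = ofʸ tt

<∞ᵇ-reflects : ∀ a b → Reflects (a <∞ b) (a <∞ᵇ b)
<∞ᵇ-reflects (fin m) (fin n) = <ᵇ-reflects-< m n
<∞ᵇ-reflects (fin _) ∞       = ofʸ tt
<∞ᵇ-reflects ∞       _       = ofⁿ id

col row : Cell → ℕ
col = proj₁
row = proj₂

_≟ᶜ_ : DecidableEquality Cell
_≟ᶜ_ = ≡-dec _≟_ _≟_

left right : Cell → Cell
left  x = (col x ∸ 1 , row x)
right x = (suc (col x) , row x)

mapRow : (ℕ → ℕ) → Cell → Cell
mapRow σ x = (col x , σ (row x))

entC : Tableau → Cell → ℕ∞
entC T x = entry T (col x) (row x)

-- x ≺ y: y is read after x in Young reading order.
_≺_ : Cell → Cell → Set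
x ≺ y = col y < col x ⊎ (col x ≡ col y × row y < row x)

_⪯_ : Cell → Cell → Set
x ⪯ y = x ≺ y ⊎ x ≡ y

≺-irrefl : ∀ {x} → ¬ (x ≺ x)
≺-irrefl (inj₁ lt)       = <-irrefl refl lt
≺-irrefl (inj₂ (_ , lt)) = <-irrefl refl lt

≺-trans : ∀ {x y z} → x ≺ y → y ≺ z → x ≺ z
≺-trans (inj₁ p)       (inj₁ q)        = inj₁ (<-trans q p)
≺-trans (inj₁ p)       (inj₂ (e , _))  = inj₁ (subst (_< _) e p)
≺-trans (inj₂ (e , _)) (inj₁ q)        = inj₁ (subst (_ <_) (sym e) q)
≺-trans (inj₂ (e , p)) (inj₂ (e′ , q)) = inj₂ (trans e e′ , <-trans q p)

≺-⪯-trans : ∀ {x y z} → x ≺ y → y ⪯ z → x ≺ z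
≺-⪯-trans x≺y (inj₁ y≺z) = ≺-trans x≺y y≺z
≺-⪯-trans x≺y (inj₂ refl) = x≺y

⪯-trans : ∀ {x y z} → x ⪯ y → y ⪯ z → x ⪯ z
⪯-trans (inj₁ x≺y) y⪯z = inj₁ (≺-⪯-trans x≺y y⪯z)
⪯-trans (inj₂ refl) y⪯z = y⪯z

≺⇒col≥ : ∀ {x y} → x ≺ y → col y ≤ col x
≺⇒col≥ (inj₁ lt)      = <⇒≤ lt
≺⇒col≥ (inj₂ (e , _)) = ≤-reflexive (sym e)

⪯⇒col≥ : ∀ {x y} → x ⪯ y → col y ≤ col x
⪯⇒col≥ (inj₁ x≺y) = ≺⇒col≥ x≺y
⪯⇒col≥ (inj₂ refl) = ≤-refl

right-mono : ∀ {x y} → x ≺ y → right x ≺ right y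
right-mono (inj₁ lt)       = inj₁ (s≤s lt)
right-mono (inj₂ (e , lt)) = inj₂ (cong suc e , lt)

mapRow-mono : ∀ {σ} → σ Preserves _<_ ⟶ _<_ → ∀ {x y} → x ≺ y → mapRow σ x ≺ mapRow σ y
mapRow-mono _    (inj₁ lt)       = inj₁ lt
mapRow-mono mono (inj₂ (e , lt)) = inj₂ (e , mono lt)

right≢ : ∀ {x} → right x ≢ x
right≢ e = 1+n≢n (cong col e)

¬≺right : ∀ {x} → ¬ (x ≺ right x)
¬≺right x≺rx = <-irrefl refl (≺⇒col≥ x≺rx)

¬left≺ : ∀ {x} → ¬ (left x ≺ x)
¬left≺ {x} (inj₁ lt)       = <⇒≱ lt (m∸n≤m (col x) 1)
¬left≺     (inj₂ (_ , lt)) = <-irrefl refl lt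

head-⪯ : ∀ {x y cs} → All (x ≺_) cs → y ∈ x ∷ cs → x ⪯ y
head-⪯ _    (here refl) = inj₂ refl
head-⪯ x≺cs (there y∈)  = inj₁ (All.lookup x≺cs y∈)

left-finite⇒2≤col : ∀ U x → entC U (left x) ≢ ∞ → 2 ≤ col x
left-finite⇒2≤col U (zero , _)        finite = ⊥-elim (finite refl)
left-finite⇒2≤col U (suc zero , _)    finite = ⊥-elim (finite refl)
left-finite⇒2≤col U (suc (suc _) , _) _      = s≤s (s≤s z≤n)

RowWeak : Row → Set
RowWeak r = ∀ i → entryL r i ≤∞ entryL r (suc i)

RowsWeak : Tableau → Set
RowsWeak T = ∀ j → RowWeak (rowAt T j)

rowWeak-singleton : ∀ k → RowWeak [ k ]
rowWeak-singleton _ zero    = tt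
rowWeak-singleton _ (suc _) = tt

rowsWeak-right : ∀ {U} → RowsWeak U → ∀ x → 1 ≤ col x → entC U x ≤∞ entC U (right x)
rowsWeak-right _  (suc _ , zero)  _ = tt
rowsWeak-right rw (suc c , suc d) _ = rw d c

entryL-beyond : ∀ r i → length r ≤ i → entryL r i ≡ ∞
entryL-beyond []      _       _         = refl
entryL-beyond (_ ∷ r) (suc i) (s≤s len) = entryL-beyond r i len

entryL-finite⇒< : ∀ r i → entryL r i ≢ ∞ → i < length r
entryL-finite⇒< []      _       finite = ⊥-elim (finite refl)
entryL-finite⇒< (_ ∷ _) zero    _      = s≤s z≤n
entryL-finite⇒< (_ ∷ r) (suc i) finite = s≤s (entryL-finite⇒< r i finite)

rowAt-nonempty⇒< : ∀ U j → 0 < length (rowAt U j) → j < length U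
rowAt-nonempty⇒< (_ ∷ _) zero    _  = s≤s z≤n
rowAt-nonempty⇒< (_ ∷ U) (suc j) ne = s≤s (rowAt-nonempty⇒< U j ne)

rowAt-finite⇒< : ∀ U j i → entryL (rowAt U j) i ≢ ∞ → j < length U
rowAt-finite⇒< U j i finite =
  rowAt-nonempty⇒< U j (≤-trans (s≤s z≤n) (entryL-finite⇒< (rowAt U j) i finite))

IsYCT⇒RowsWeak : ∀ {P} → IsYCT P → RowsWeak P
IsYCT⇒RowsWeak {P} yct j i with suc i <? length (rowAt P j)
... | yes lt = IsYCT.rowsWeak yct (suc i) (suc j) (s≤s z≤n)
                 (rowAt-nonempty⇒< P j (≤-trans (s≤s z≤n) lt)) (s≤s z≤n) lt
... | no ¬lt rewrite entryL-beyond (rowAt P j) (suc i) (≮⇒≥ ¬lt) = ≤∞-∞ _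

entryL-setL-here : ∀ r i k → i ≤ length r → entryL (setL r i k) i ≡ fin k
entryL-setL-here []      zero    k _         = refl
entryL-setL-here (_ ∷ _) zero    k _         = refl
entryL-setL-here (_ ∷ r) (suc i) k (s≤s len) = entryL-setL-here r i k len

entryL-setL-elsewhere : ∀ r i k i′ → i ≤ length r → i′ ≢ i → entryL (setL r i k) i′ ≡ entryL r i′
entryL-setL-elsewhere []      zero    k zero     _         ne = ⊥-elim (ne refl)
entryL-setL-elsewhere []      zero    k (suc _)  _         _  = refl
entryL-setL-elsewhere (_ ∷ _) zero    k zero     _         ne = ⊥-elim (ne refl)
entryL-setL-elsewhere (_ ∷ _) zero    k (suc _)  _         _  = refl
entryL-setL-elsewhere (_ ∷ _) (suc i) k zero     _         _  = refl
entryL-setL-elsewhere (_ ∷ r) (suc i) k (suc i′) (s≤s len) ne =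
  entryL-setL-elsewhere r i k i′ len (ne ∘ cong suc)

rowAt-setT-here : ∀ U i j k → j < length U → rowAt (setT U i j k) j ≡ setL (rowAt U j) i k
rowAt-setT-here (_ ∷ _) i zero    k _        = refl
rowAt-setT-here (_ ∷ U) i (suc j) k (s≤s lt) = rowAt-setT-here U i j k lt

rowAt-setT-elsewhere : ∀ U i j k j′ → j′ ≢ j → rowAt (setT U i j k) j′ ≡ rowAt U j′
rowAt-setT-elsewhere []      i j       k j′       _  = refl
rowAt-setT-elsewhere (_ ∷ _) i zero    k zero     ne = ⊥-elim (ne refl)
rowAt-setT-elsewhere (_ ∷ _) i zero    k (suc _)  _  = refl
rowAt-setT-elsewhere (_ ∷ _) i (suc j) k zero     _  = refl
rowAt-setT-elsewhere (_ ∷ U) i (suc j) k (suc j′) ne =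
  rowAt-setT-elsewhere U i j k j′ (ne ∘ cong suc)

-- A finite left neighbour guarantees that x is a cell of the diagram or the cell just past
-- the end of its row, which is where place puts k.
place-here : ∀ U x k → entC U (left x) ≢ ∞ → entC (place U x k) x ≡ fin k
place-here U (zero , _)              k finite = ⊥-elim (finite refl)
place-here U (suc zero , _)          k finite = ⊥-elim (finite refl)
place-here U (suc (suc c) , zero)    k finite = ⊥-elim (finite refl)
place-here U (suc (suc c) , suc d) k finite
  rewrite rowAt-setT-here U (suc c) d k (rowAt-finite⇒< U d c finite) =
  entryL-setL-here (rowAt U d) (suc c) k (entryL-finite⇒< (rowAt U d) c finite)

place-elsewhere : ∀ U x k y → entC U (left x) ≢ ∞ → y ≢ x → entC (place U x k) y ≡ entC U y
place-elsewhere U (zero , _)           k y       finite _ = ⊥-elim (finite refl)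
place-elsewhere U (suc zero , _)       k y       finite _ = ⊥-elim (finite refl)
place-elsewhere U (suc (suc c) , zero) k y       finite _ = ⊥-elim (finite refl)
place-elsewhere U (suc (suc c) , suc d) k (zero , _)          _ _ = refl
place-elsewhere U (suc (suc c) , suc d) k (suc _ , zero)      _ _ = refl
place-elsewhere U (suc (suc c) , suc d) k (suc c′ , suc d′) finite y≢x with d′ ≟ d
... | no d′≢d rewrite rowAt-setT-elsewhere U (suc c) d k d′ d′≢d = refl
... | yes refl
  rewrite rowAt-setT-here U (suc c) d k (rowAt-finite⇒< U d c finite) =
  entryL-setL-elsewhere (rowAt U d) (suc c) k c′ (entryL-finite⇒< (rowAt U d) c finite)
    (λ e → y≢x (cong (λ i → (suc i , suc d)) e))

Fits : Tableau → ℕ → Cell → Set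
Fits U k x = entC U (left x) ≤∞ fin k × fin k <∞ entC U x

rowsWeak-place : ∀ {U x k} → RowsWeak U → Fits U k x → RowsWeak (place U x k)
rowsWeak-place {U} {x} {k} rw (left≤k , k<x) = weak
  where
  finite : entC U (left x) ≢ ∞
  finite = ≤fin⇒≢∞ left≤k

  weak : RowsWeak (place U x k)
  weak j i with (suc (suc i) , suc j) ≟ᶜ x | (suc i , suc j) ≟ᶜ x
  ... | yes refl | _ =
    subst₂ _≤∞_ (sym (place-elsewhere U x k (left x) finite (right≢ ∘ sym)))
      (sym (place-here U x k finite)) left≤k
  ... | no _ | yes refl =
    subst₂ _≤∞_ (sym (place-here U x k finite))
      (sym (place-elsewhere U x k (right x) finite right≢)) (≤∞-trans (<∞⇒≤∞ k<x) (rw j i))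
  ... | no ≢x | no ≢x′ =
    subst₂ _≤∞_ (sym (place-elsewhere U x k _ finite ≢x′))
      (sym (place-elsewhere U x k _ finite ≢x)) (rw j i)

rowsWeak-newRow : ∀ k U → RowsWeak U → RowsWeak (proj₁ (newRow k U))
rowsWeak-newRow k []       _  zero    = rowWeak-singleton k
rowsWeak-newRow k []       _  (suc _) = λ _ → tt
rowsWeak-newRow k (r ∷ rs) rw j with entryL r 0 <∞ᵇ fin k
rowsWeak-newRow k (r ∷ rs) rw zero    | true  = rw zero
rowsWeak-newRow k (r ∷ rs) rw (suc j) | true  = rowsWeak-newRow k rs (rw ∘ suc) j
rowsWeak-newRow k (r ∷ rs) rw zero    | false = rowWeak-singleton k
rowsWeak-newRow k (r ∷ rs) rw (suc j) | false = rw j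

punchIn : ℕ → ℕ → ℕ
punchIn zero    j       = suc j
punchIn (suc p) zero    = zero
punchIn (suc p) (suc j) = suc (punchIn p j)

punchIn-mono : ∀ p → punchIn p Preserves _<_ ⟶ _<_
punchIn-mono zero    lt                 = s≤s lt
punchIn-mono (suc p) {zero}  {suc _} _  = s≤s z≤n
punchIn-mono (suc p) {suc _} {suc _} lt = s≤s (punchIn-mono p (≤-pred lt))

newRow-rows : ∀ k U → Σ ℕ λ p →
  proj₂ (newRow k U) ≡ suc p × rowAt (proj₁ (newRow k U)) p ≡ [ k ] ×
  (∀ j → rowAt (proj₁ (newRow k U)) (punchIn p j) ≡ rowAt U j)
newRow-rows k [] = 0 , refl , refl , λ _ → refl
newRow-rows k (r ∷ rs) with entryL r 0 <∞ᵇ fin k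
... | true  = let p , row≡ , new≡ , old≡ = newRow-rows k rs in
  suc p , cong suc row≡ , new≡ , λ { zero → refl ; (suc j) → old≡ j }
... | false = 0 , refl , refl , λ _ → refl

entC-punchIn : ∀ {T U p} → (∀ j → rowAt T (punchIn p j) ≡ rowAt U j) →
  ∀ y → entC T (mapRow (punchIn (suc p)) y) ≡ entC U y
entC-punchIn _    (zero , _)      = refl
entC-punchIn _    (suc _ , zero)  = refl
entC-punchIn old≡ (suc c , suc d) = cong (λ r → entryL r c) (old≡ d)

-- readingCells T unfolds to concatMap (columnCells T) (map (2 +_) (downFrom (maxα T))).
cellIf : Tableau → ℕ → ℕ → List Cell
cellIf T c d = if c ≤ᵇ α T d + 1 then [ (c , d) ] else []

columnCells : Tableau → ℕ → List Cell
columnCells T c = concatMap (cellIf T c) (map suc (downFrom (ℓ T)))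

cellIf-≡ : ∀ T c d → All (_≡ (c , d)) (cellIf T c d)
cellIf-≡ T c d with c ≤ᵇ α T d + 1
... | true  = refl ∷ []
... | false = []

cellIf-sorted : ∀ T c d → AllPairs _≺_ (cellIf T c d)
cellIf-sorted T c d with c ≤ᵇ α T d + 1
... | true  = [] ∷ []
... | false = []

∈-cellIf : ∀ T c d → True (c ≤ᵇ α T d + 1) → (c , d) ∈ cellIf T c d
∈-cellIf T c d _ with c ≤ᵇ α T d + 1
... | true = here refl

columnCells-col : ∀ T c → All (λ x → col x ≡ c) (columnCells T c)
columnCells-col T c =
  Allₚ.concat⁺ (Allₚ.map⁺ {xs = map suc (downFrom (ℓ T))}
    (All.tabulate λ {d} _ → All.map (λ { refl → refl }) (cellIf-≡ T c d)))

downFrom-decreasing : ∀ n → AllPairs _>_ (downFrom n)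
downFrom-decreasing n = AllPairsₚ.applyDownFrom⁺₁ id n (λ j<i _ → j<i)

map-decreasing : ∀ {f} → f Preserves _<_ ⟶ _<_ → ∀ {ns} → AllPairs _>_ ns → AllPairs _>_ (map f ns)
map-decreasing mono ns> = AllPairsₚ.map⁺ (AllPairs.map mono ns>)

concatMap-sorted : ∀ {A : Set} {R : A → A → Set} (f : ℕ → List A) ns → AllPairs _>_ ns →
  (∀ n → AllPairs R (f n)) → (∀ {m n} → n < m → All (λ x → All (R x) (f n)) (f m)) →
  AllPairs R (concatMap f ns)
concatMap-sorted f _ ns> sorted cross =
  AllPairsₚ.concat⁺ (Allₚ.map⁺ (All.tabulate λ {n} _ → sorted n))
    (AllPairsₚ.map⁺ (AllPairs.map cross ns>))

columnCells-sorted : ∀ T c → AllPairs _≺_ (columnCells T c)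
columnCells-sorted T c =
  concatMap-sorted (cellIf T c) _ (map-decreasing s≤s (downFrom-decreasing (ℓ T)))
    (cellIf-sorted T c) cross
  where
  cross : ∀ {m n} → n < m → All (λ x → All (x ≺_) (cellIf T c n)) (cellIf T c m)
  cross {m} {n} n<m =
    All.map (λ { refl → All.map (λ { refl → inj₂ (refl , n<m) }) (cellIf-≡ T c n) })
      (cellIf-≡ T c m)

readingCells-sorted : ∀ T → AllPairs _≺_ (readingCells T)
readingCells-sorted T =
  concatMap-sorted (columnCells T) _ (map-decreasing (s≤s ∘ s≤s) (downFrom-decreasing (maxα T)))
    (columnCells-sorted T) cross
  where
  cross : ∀ {m n} → n < m → All (λ x → All (x ≺_) (columnCells T n)) (columnCells T m)
  cross {m} {n} n<m =
    All.map (λ { refl → All.map (λ { refl → inj₁ n<m }) (columnCells-col T n) })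
      (columnCells-col T m)

length-rowAt≤maxα : ∀ T j → length (rowAt T j) ≤ maxα T
length-rowAt≤maxα []      _       = z≤n
length-rowAt≤maxα (r ∷ T) zero    = m≤m⊔n (length r) (maxα T)
length-rowAt≤maxα (r ∷ T) (suc j) = ≤-trans (length-rowAt≤maxα T j) (m≤n⊔m (length r) (maxα T))

∈-concatMap : ∀ {A B : Set} {f : A → List B} {x xs y} → x ∈ xs → y ∈ f x → y ∈ concatMap f xs
∈-concatMap {f = f} x∈ y∈ = ∈ₚ.∈-concatMap⁺ f (lose x∈ y∈)

right-∈-readingCells : ∀ T x → entC T x ≢ ∞ → right x ∈ readingCells T
right-∈-readingCells T (zero , _)      finite = ⊥-elim (finite refl)
right-∈-readingCells T (suc _ , zero)  finite = ⊥-elim (finite refl)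
right-∈-readingCells T (suc i , suc j) finite =
  ∈-concatMap (∈ₚ.∈-map⁺ (2 +_) (∈ₚ.∈-downFrom⁺ (≤-trans i<len (length-rowAt≤maxα T j))))
    (∈-concatMap (∈ₚ.∈-map⁺ suc (∈ₚ.∈-downFrom⁺ (rowAt-finite⇒< T j i finite)))
      (∈-cellIf T (2 + i) (suc j)
        (≤⇒≤ᵇ (subst (2 + i ≤_) (+-comm 1 (length (rowAt T j))) (s≤s i<len)))))
  where
  i<len : i < length (rowAt T j)
  i<len = entryL-finite⇒< (rowAt T j) i finite

module _ (P : ℕ → List Cell → Tableau → Tableau × Cell → Set)
  (base : ∀ k U → P k [] U (scan k [] U))
  (skip : ∀ {k x cs U} → ¬ Fits U k x → P k cs U (scan k cs U) → P k (x ∷ cs) U (scan k cs U))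
  (stop : ∀ {k x cs U} → Fits U k x → entC U x ≡ ∞ → P k (x ∷ cs) U (place U x k , x))
  (bump : ∀ {k v x cs U} → Fits U k x → entC U x ≡ fin v →
    P v cs (place U x k) (scan v cs (place U x k)) → P k (x ∷ cs) U (scan v cs (place U x k)))
  where

  scan-elim : ∀ k cs U → P k cs U (scan k cs U)
  scan-elim k []             U = base k U
  scan-elim k ((c , d) ∷ cs) U
    with (entry U (c ∸ 1) d ≤∞ᵇ fin k) ∧ (fin k <∞ᵇ entry U c d)
       | ≤∞ᵇ-reflects (entry U (c ∸ 1) d) (fin k) ×-reflects <∞ᵇ-reflects (fin k) (entry U c d)
  ... | false | ofⁿ misfit = skip misfit (scan-elim k cs U)
  ... | true  | ofʸ (left≤k , k<x) with entry U c d in x≡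
  ...   | ∞     = stop (left≤k , subst (fin k <∞_) (sym x≡) k<x) x≡
  ...   | fin v =
    bump (left≤k , subst (fin k <∞_) (sym x≡) k<x) x≡ (scan-elim v cs (place U (c , d) k))

rowsWeak-insert : ∀ k U → RowsWeak U → RowsWeak (k ⇒ U)
rowsWeak-insert k U = scan-elim (λ _ _ U R → RowsWeak U → RowsWeak (proj₁ R))
  rowsWeak-newRow
  (λ _ ih → ih)
  (λ {k} {x} {_} {U} fits _ rw → rowsWeak-place {U} {x} {k} rw fits)
  (λ {k} {_} {x} {_} {U} fits _ ih rw → ih (rowsWeak-place {U} {x} {k} rw fits))
  k (readingCells U) U

-- BumpPath T b p c: cells p = p₀ ≺ p₁ ≺ … ≺ pₙ with T p₀ ≤ b, T pᵢ₊₁ ≤ T (right pᵢ),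
-- T (right pₙ) = ∞ and c = col pₙ: the trace left in T by inserting b.
data BumpPath (T : Tableau) : ℕ∞ → Cell → ℕ → Set where
  end  : ∀ {b p} → entC T p ≤∞ b → entC T (right p) ≡ ∞ → BumpPath T b p (col p)
  step : ∀ {b p q c} → entC T p ≤∞ b → p ≺ q → BumpPath T (entC T (right p)) q c → BumpPath T b p c

path-head : ∀ {T b p c} → BumpPath T b p c → entC T p ≤∞ b
path-head (end p≤b _)    = p≤b
path-head (step p≤b _ _) = p≤b

path-col : ∀ {T b p c} → BumpPath T b p c → c ≤ col p
path-col (end _ _)         = ≤-refl
path-col (step _ p≺q path) = ≤-trans (path-col path) (≺⇒col≥ p≺q)

path-weaken : ∀ {T b b′ p c} → b ≤∞ b′ → BumpPath T b p c → BumpPath T b′ p c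
path-weaken b≤b′ (end p≤b right∞)   = end (≤∞-trans p≤b b≤b′) right∞
path-weaken b≤b′ (step p≤b p≺q path) = step (≤∞-trans p≤b b≤b′) p≺q path

path-next : ∀ {T b p c w} → BumpPath T b p c → entC T (right p) ≤∞ fin w →
  Σ Cell λ q → p ≺ q × BumpPath T (fin w) q c
path-next (end _ right∞) right≤w = ⊥-elim (≤fin⇒≢∞ right≤w right∞)
path-next (step _ p≺q path) right≤w = _ , p≺q , path-weaken right≤w path

-- The relabelling of rows accounts for the row that newRow may insert at the end of the scan.
record Traced (k : ℕ) (cs : List Cell) (U : Tableau) (R : Tableau × Cell) : Set where
  field
    relabel      : ℕ → ℕ
    relabel-mono : relabel Preserves _<_ ⟶ _<_
    unchanged    : ∀ y → y ∉ cs → entC (proj₁ R) (mapRow relabel y) ≡ entC U y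
    start        : Cell
    path         : BumpPath (proj₁ R) (fin k) start (col (proj₂ R))
    before-start : ∀ y → 2 ≤ col y → All (y ≺_) cs → mapRow relabel y ≺ start

traced-newRow : ∀ k U → Traced k [] U (scan k [] U)
traced-newRow k U with newRow-rows k U
... | p , row≡ , new≡ , old≡ rewrite row≡ = record
  { relabel      = punchIn (suc p)
  ; relabel-mono = punchIn-mono (suc p)
  ; unchanged    = λ y _ → entC-punchIn old≡ y
  ; start        = (1 , suc p)
  ; path         = end (≤∞-reflexive (cong (λ r → entryL r 0) new≡)) (cong (λ r → entryL r 1) new≡)
  ; before-start = λ _ 2≤col _ → inj₁ 2≤col
  }

traced-skip : ∀ {k x cs U R} → Traced k cs U R → Traced k (x ∷ cs) U R
traced-skip t = record
  { relabel      = relabel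
  ; relabel-mono = relabel-mono
  ; unchanged    = λ y y∉ → unchanged y (y∉ ∘ there)
  ; start        = start
  ; path         = path
  ; before-start = λ y 2≤col y≺ → before-start y 2≤col (All.tail y≺)
  }
  where open Traced t

traced-stop : ∀ {k x cs U} → RowsWeak U → All (x ≺_) cs → Fits U k x → entC U x ≡ ∞ →
  Traced k (x ∷ cs) U (place U x k , x)
traced-stop {k} {x} {cs} {U} rw _ (left≤k , _) x∞ = record
  { relabel      = id
  ; relabel-mono = id
  ; unchanged    = λ y y∉ → place-elsewhere U x k y finite (y∉ ∘ here)
  ; start        = x
  ; path         = end (≤∞-reflexive (place-here U x k finite))
                       (trans (place-elsewhere U x k (right x) finite right≢) (∞≤⇒≡∞ ∞≤right))
  ; before-start = λ _ _ y≺ → All.head y≺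
  }
  where
  finite : entC U (left x) ≢ ∞
  finite = ≤fin⇒≢∞ left≤k

  ∞≤right : ∞ ≤∞ entC U (right x)
  ∞≤right =
    subst (_≤∞ entC U (right x)) x∞ (rowsWeak-right rw x (<⇒≤ (left-finite⇒2≤col U x finite)))

traced-bump : ∀ {k v x cs U R} → RowsWeak U → All (x ≺_) cs → Fits U k x → entC U x ≡ fin v →
  Traced v cs (place U x k) R → Traced k (x ∷ cs) U R
traced-bump {k} {v} {x} {cs} {U} {R} rw x≺cs (left≤k , _) x≡v t = record
  { relabel      = relabel
  ; relabel-mono = relabel-mono
  ; unchanged    = λ y y∉ →
      trans (unchanged y (y∉ ∘ there)) (place-elsewhere U x k y finite (y∉ ∘ here))
  ; start        = mapRow relabel x
  ; path         = step holds-k (before-start x 2≤col x≺cs) (path-weaken v≤right path)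
  ; before-start = λ _ _ y≺ → mapRow-mono relabel-mono (All.head y≺)
  }
  where
  open Traced t
  finite : entC U (left x) ≢ ∞
  finite = ≤fin⇒≢∞ left≤k

  2≤col : 2 ≤ col x
  2≤col = left-finite⇒2≤col U x finite

  holds-k : entC (proj₁ R) (mapRow relabel x) ≤∞ fin k
  holds-k =
    ≤∞-reflexive (trans (unchanged x (≺-irrefl ∘ All.lookup x≺cs)) (place-here U x k finite))

  v≤right : fin v ≤∞ entC (proj₁ R) (mapRow relabel (right x))
  v≤right = subst (fin v ≤∞_)
    (sym (trans (unchanged (right x) (¬≺right ∘ All.lookup x≺cs))
                (place-elsewhere U x k (right x) finite right≢)))
    (subst (_≤∞ entC U (right x)) x≡v (rowsWeak-right rw x (<⇒≤ 2≤col)))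

scan-traced : ∀ k cs U → RowsWeak U → AllPairs _≺_ cs → Traced k cs U (scan k cs U)
scan-traced = scan-elim (λ k cs U R → RowsWeak U → AllPairs _≺_ cs → Traced k cs U R)
  (λ k U _ _ → traced-newRow k U)
  (λ _ ih rw sorted → traced-skip (ih rw (AllPairs.tail sorted)))
  (λ fits x∞ rw sorted → traced-stop rw (AllPairs.head sorted) fits x∞)
  (λ {k} {_} {x} {_} {U} fits x≡v ih rw sorted →
    traced-bump rw (AllPairs.head sorted) fits x≡v
      (ih (rowsWeak-place {U} {x} {k} rw fits) (AllPairs.tail sorted)))

insertion-path : ∀ k U → RowsWeak U → Σ Cell λ p → BumpPath (k ⇒ U) (fin k) p (col (newCell k U))
insertion-path k U rw = Traced.start traced , Traced.path traced
  where
  traced : Traced k (readingCells U) U (insertWithCell k U)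
  traced = scan-traced k (readingCells U) U rw (readingCells-sorted U)

AgreeExceptBefore : Tableau → Tableau → List Cell → Set
AgreeExceptBefore U T cs = ∀ y → ¬ All (y ≺_) cs → entC U y ≡ entC T y

agree-tail : ∀ {U T x cs} → AgreeExceptBefore U T (x ∷ cs) → AgreeExceptBefore U T cs
agree-tail agree y ¬y≺cs = agree y (¬y≺cs ∘ All.tail)

agree-place : ∀ {U T x cs} k → AgreeExceptBefore U T (x ∷ cs) → All (x ≺_) cs →
  entC U (left x) ≢ ∞ → AgreeExceptBefore (place U x k) T cs
agree-place {U} {x = x} k agree x≺cs finite y ¬y≺cs with y ≟ᶜ x
... | yes refl = ⊥-elim (¬y≺cs x≺cs)
... | no y≢x   = trans (place-elsewhere U x k y finite y≢x) (agree-tail agree y ¬y≺cs)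

agree-here : ∀ {U T x cs} → AgreeExceptBefore U T (x ∷ cs) → entC U x ≡ entC T x
agree-here {x = x} agree = agree x (≺-irrefl ∘ All.head)

agree-left : ∀ {U T x cs} → AgreeExceptBefore U T (x ∷ cs) → entC U (left x) ≡ entC T (left x)
agree-left {x = x} agree = agree (left x) (¬left≺ ∘ All.head)

Pending : Tableau → Cell → List Cell → Set
Pending T p cs = ∀ z → right p ⪯ z → z ∈ readingCells T → z ∈ cs

pending-tail : ∀ {T p q x cs} → Pending T p (x ∷ cs) → right p ⪯ right q → x ≺ right q →
  Pending T q cs
pending-tail pending p⪯q x≺q z q⪯z z∈ with pending z (⪯-trans p⪯q q⪯z) z∈
... | here refl = ⊥-elim (≺-irrefl (≺-⪯-trans x≺q q⪯z))
... | there z∈cs = z∈cs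

pending-right : ∀ {T w p c cs} → BumpPath T (fin w) p c → Pending T p cs → right p ∈ cs
pending-right {T} {p = p} path pending =
  pending (right p) (inj₂ refl) (right-∈-readingCells T p (≤fin⇒≢∞ (path-head path)))

RightOfPath : Tableau → ℕ → ℕ → List Cell → Tableau → Tableau × Cell → Set
RightOfPath T c w cs U R = AllPairs _≺_ cs → AgreeExceptBefore U T cs →
  ∀ p → BumpPath T (fin w) p c → Pending T p cs → c < col (proj₂ R)

scan-right-of-path : ∀ T c w cs U → RightOfPath T c w cs U (scan w cs U)
scan-right-of-path T c = scan-elim (RightOfPath T c) base skip stop bump
  where
  base : ∀ w U → RightOfPath T c w [] U (scan w [] U)
  base _ _ _ _ _ path pending with () ← pending-right path pending

  skip : ∀ {w x cs U} → ¬ Fits U w x → RightOfPath T c w cs U (scan w cs U) →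
    RightOfPath T c w (x ∷ cs) U (scan w cs U)
  skip {w} {U = U} misfit ih (x≺cs ∷ sorted) agree p path pending with pending-right path pending
  ... | there right∈cs =
    ih sorted (agree-tail agree) p path
      (pending-tail {T} pending (inj₂ refl) (All.lookup x≺cs right∈cs))
  ... | here refl =
    let q , p≺q , path′ = path-next path right≤w in
    ih sorted (agree-tail agree) q path′
      (pending-tail {T} pending (inj₁ (right-mono p≺q)) (right-mono p≺q))
    where
    p≤w : entC U p ≤∞ fin w
    p≤w = subst (_≤∞ fin w) (sym (agree-left agree)) (path-head path)

    right≤w : entC T (right p) ≤∞ fin w
    right≤w = subst (_≤∞ fin w) (agree-here agree) (≮∞⇒≥ _ (λ w<right → misfit (p≤w , w<right)))

  stop : ∀ {w x cs U} → Fits U w x → entC U x ≡ ∞ → RightOfPath T c w (x ∷ cs) U (place U x w , x)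
  stop _ _ (x≺cs ∷ _) _ p path pending =
    ≤-trans (s≤s (path-col path)) (⪯⇒col≥ (head-⪯ x≺cs (pending-right path pending)))

  bump : ∀ {w v x cs U} → Fits U w x → entC U x ≡ fin v →
    RightOfPath T c v cs (place U x w) (scan v cs (place U x w)) →
    RightOfPath T c w (x ∷ cs) U (scan v cs (place U x w))
  bump {w} (left≤w , w<x) x≡v ih (x≺cs ∷ sorted) agree p path pending
    with pending-right path pending
  ... | there right∈cs =
    ih sorted (agree-place w agree x≺cs (≤fin⇒≢∞ left≤w)) p
      (path-weaken (<⇒≤ (subst (fin w <∞_) x≡v w<x)) path)
      (pending-tail {T} pending (inj₂ refl) (All.lookup x≺cs right∈cs))
  ... | here refl =
    let q , p≺q , path′ = path-next path (≤∞-reflexive (trans (sym (agree-here agree)) x≡v)) in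
    ih sorted (agree-place w agree x≺cs (≤fin⇒≢∞ left≤w)) q path′
      (pending-tail {T} pending (inj₁ (right-mono p≺q)) (right-mono p≺q))

insertion-right-of-path : ∀ T w p c → BumpPath T (fin w) p c → c < col (newCell w T)
insertion-right-of-path T w p c path =
  scan-right-of-path T c w (readingCells T) T (readingCells-sorted T) (λ _ _ → refl)
    p path (λ _ _ z∈ → z∈)

newCell-col-increasing : ∀ P → RowsWeak P → ∀ {c d} → c ≤ d →
  col (newCell c P) < col (newCell d (c ⇒ P))
newCell-col-increasing P rw {c} {d} c≤d =
  let p , path = insertion-path c P rw in
  insertion-right-of-path (c ⇒ P) d p _ (path-weaken c≤d path)

insertSeq-col-increasing : ∀ P → RowsWeak P → ∀ {cs} → Linked _≤_ cs →
  Linked _<_ (map col (proj₂ (insertSeq cs P)))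
insertSeq-col-increasing _ _  []                   = []
insertSeq-col-increasing _ _  [-]                  = [-]
insertSeq-col-increasing P rw (_∷_ {c} c≤d sorted) =
  newCell-col-increasing P rw c≤d ∷ insertSeq-col-increasing (c ⇒ P) (rowsWeak-insert c P rw) sorted

mainTheorem2 :
    ((P : Tableau) → IsYCT P → (c d : ℕ) → 1 ≤ c → c ≤ d →
      proj₁ (newCell c P) < proj₁ (newCell d (c ⇒ P)))
    ×
    ((P : Tableau) → IsYCT P → (cs : List ℕ) → All (1 ≤_) cs → Linked _≤_ cs →
      Linked _<_ (map proj₁ (proj₂ (insertSeq cs P))))
mainTheorem2 =
  (λ P yct _ _ _ c≤d → newCell-col-increasing P (IsYCT⇒RowsWeak yct) c≤d) ,
  (λ P yct _ _ sorted → insertSeq-col-increasing P (IsYCT⇒RowsWeak yct) sorted)
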